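{- Let $p\geq 2$ and $Q=\lceil\log_2 p\rceil$. Consider the $q'$-doubling exclusive scan algorithm (described in the context) for integers $1\leq q'\leq Q$. It uses a total of $\left\lceil\log_2\left(\frac{2^{q'}}{2^{q'}-1}(p-1)\right)\right\rceil$ communication rounds. The smallest number $q'$ of inclusive-scan rounds for which this total equals $Q$ is the smallest integer $q'$ satisfying $q'\geq Q-\log_2(2^Q-p+1)$.
   Context: Model: there are $p$ processors ranked $0,\dots,p-1$. Processor $r$ holds input vector $V_r$, and $\oplus$ is an associative binary operator. In each communication round, every processor may simultaneously send one vector to one processor and receive one vector from one processor. The goal is to compute the exclusive prefix sums $W_r=V_0\oplus\cdots\oplus V_{r-1}$ for $1\leq r\leq p-1$. The $q'$-doubling exclusive scan algorithm with parameter $p'=2^{q'}$ proceeds as follows for processor $r$. Round 0 (skip $s=1$): $r$ sends $V_r$ to $r+1$ if $r+1<p$, and receives into $W$ from $r-1$ if $r\geq 1$. Inclusive phase: set $s=2$. While $s<p'$: a processor $r$ with $r-s\geq 0$ receives $T$ from $r-s$ and sets $W\gets T\oplus W$. A processor with $r+s<p$ sends $W\oplus V_r$ to $r+s$, computed before its update; processor $0$ sends $V_0$. Then set $s\gets 2s$. This phase consists of $q'$ rounds including round 0. Adjustment: set $s\gets s-1$. Exclusive phase: while $s<p-1$: a processor with $r-s\geq 1$ receives $T$ from $r-s$ and sets $W\gets T\oplus W$. A processor with $r\geq 1$ and $r+s<p$ sends its $W$ to $r+s$. Then set $s\gets 2s$. -}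

module Defs where

open import Data.Nat using (ℕ; zero; suc; _+_; _*_; _∸_; _^_; _≤_; _<_; _<?_)
open import Data.Product using (_×_; _,_; proj₁; proj₂)
open import Relation.Nullary using (yes; no)

-- Count of iterations of the loop  "while s < bound: (one round); s ← 2s",
-- together with the final value of s.  The first argument is fuel; whenever
-- s ≥ 1 (always the case below) fuel ≥ bound is more than enough, so the
-- fuel never cuts the loop short.
whileDouble : (fuel s bound : ℕ) → ℕ × ℕ
whileDouble zero    s b = 0 , s
whileDouble (suc f) s b with s <? b
... | yes _ = let r = whileDouble f (2 * s) b in suc (proj₁ r) , proj₂ r
... | no  _ = 0 , s

-- Total number of communication rounds of the q'-doubling exclusive scan on
-- p processors:  round 0 (skip 1), the inclusive phase loop starting with
-- s = 2 while s < p' = 2^q', the adjustment s ← s - 1, and the exclusive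
-- phase loop while s < p - 1.
totalRounds : (p q' : ℕ) → ℕ
totalRounds p q' =
  let p'   = 2 ^ q'
      inc  = whileDouble p' 2 p'
      exc  = whileDouble p (proj₂ inc ∸ 1) (p ∸ 1)
  in 1 + proj₁ inc + proj₁ exc

-- CeilLog2 a b k :  k = ⌈ log₂ (a / b) ⌉  for a rational a/b ≥ 1 (b > 0),
-- i.e. k is the least natural number with a / b ≤ 2^k.
CeilLog2 : (a b k : ℕ) → Set
CeilLog2 a b k = (a ≤ 2 ^ k * b) × (∀ j → a ≤ 2 ^ j * b → k ≤ j)

IsLeast : (ℕ → Set) → ℕ → Set
IsLeast P n = P n × (∀ m → P m → n ≤ m)

-- The condition  q ≥ Q - log₂ (2^Q - p + 1)  (with 2^Q - p + 1 ≥ 1),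
-- written without real logarithms:  2^Q ≤ 2^q · (2^Q - p + 1).
BoundCond : (p Q q : ℕ) → Set
BoundCond p Q q = 2 ^ Q ≤ 2 ^ q * (2 ^ Q + 1 ∸ p)

-- The inclusive phase doubles s from 2 up to 2^q′ in q′ - 1 rounds, so the exclusive phase starts
-- at s = 2^q′ - 1 and runs for e = ⌈log₂ ((p - 1) / (2^q′ - 1))⌉ rounds.  Multiplying by 2^q′ gives
-- 1 + (q′ - 1) + e = ⌈log₂ (2^q′ (p - 1) / (2^q′ - 1))⌉, because 2^q′ (p - 1) ≤ 2^j (2^q′ - 1) forces
-- p ≤ 2^j, hence j ≥ Q ≥ q′.  The same implication shows that the total is never below Q, so it
-- equals Q exactly when 2^q′ (p - 1) ≤ 2^Q (2^q′ - 1), which rearranges to 2^Q ≤ 2^q′ (2^Q - p + 1).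

module Submission where

open import Defs
open import Data.Nat
open import Data.Nat.Properties
open import Data.Nat.Induction using (<-rec)
open import Data.Nat.Logarithm
open import Data.Nat.Tactic.RingSolver using (solve-∀)
open import Data.Empty using (⊥-elim)
open import Data.Product using (_×_; _,_; proj₁; proj₂)
open import Data.Sum using (inj₁; inj₂)
open import Data.Product.Properties using (×-≡,≡→≡)
open import Function.Bundles using (_⇔_; mk⇔; Equivalence)
open import Function.Construct.Composition using (_⇔-∘_)
open import Function.Construct.Symmetry using (⇔-sym)
open import Relation.Binary.PropositionalEquality
open import Relation.Nullary using (yes; no; contradiction)

open Equivalence using (to; from)

n<2^n : ∀ n → n < 2 ^ n
n<2^n zero    = s≤s z≤n
n<2^n (suc n) = ≤-<-trans (n<2^n n) (m<m+n (2 ^ n) (≤-trans (m^n>0 2 n) (m≤m+n (2 ^ n) 0)))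

^-cancelʳ-≤ : ∀ m {a b} → 1 < m → m ^ a ≤ m ^ b → a ≤ b
^-cancelʳ-≤ m 1<m m^a≤m^b = ≮⇒≥ λ b<a → <⇒≱ (^-monoʳ-< m 1<m b<a) m^a≤m^b

2^m*[2^n*o]≡2^[m+n]*o : ∀ m n o → 2 ^ m * (2 ^ n * o) ≡ 2 ^ (m + n) * o
2^m*[2^n*o]≡2^[m+n]*o m n o = trans (sym (*-assoc (2 ^ m) (2 ^ n) o)) (cong (_* o) (sym (^-distribˡ-+-* 2 m n)))

2^m*[2*o]≡2^[1+m]*o : ∀ m o → 2 ^ m * (2 * o) ≡ 2 ^ suc m * o
2^m*[2*o]≡2^[1+m]*o m o = trans (sym (*-assoc (2 ^ m) 2 o)) (cong (_* o) (*-comm (2 ^ m) 2))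

*-pred-≤⇒< : ∀ {x n X} → 0 < x → 0 < X → X * n ≤ x * (X ∸ 1) → n < x
*-pred-≤⇒< {x@(suc _)} {n} {X@(suc X′)} _ _ Xn≤ = ≰⇒> λ x≤n → <⇒≱ (begin-strict
  x * X′  <⟨ *-monoʳ-< x (n<1+n X′) ⟩
  x * X   ≤⟨ *-monoˡ-≤ X x≤n ⟩
  n * X   ≡⟨ *-comm n X ⟩
  X * n   ∎) Xn≤
  where open ≤-Reasoning

≤-translate : ∀ {a b a′ b′} c → a + c ≡ a′ → b + c ≡ b′ → a ≤ b ⇔ a′ ≤ b′
≤-translate c refl refl = mk⇔ (+-monoˡ-≤ c) (+-cancelʳ-≤ c _ _)

m≤n⇒m≤2^n*o : ∀ {m n o} → m ≤ n → 1 ≤ o → m ≤ 2 ^ n * o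
m≤n⇒m≤2^n*o {n = n} {o} m≤n 1≤o =
  ≤-trans m≤n (≤-trans (<⇒≤ (n<2^n n)) (m≤m*n (2 ^ n) o {{>-nonZero 1≤o}}))

⌈log₂⌉-least : ∀ {n k} → n ≤ 2 ^ k → ⌈log₂ n ⌉ ≤ k
⌈log₂⌉-least {n} {k} n≤2^k = subst (⌈log₂ n ⌉ ≤_) (⌈log₂2^n⌉≡n k) (⌈log₂⌉-mono-≤ n≤2^k)

n≤2^⌈log₂n⌉ : ∀ n → n ≤ 2 ^ ⌈log₂ n ⌉
n≤2^⌈log₂n⌉ = <-rec _ bound
  where
  bound : ∀ n → (∀ {m} → m < n → m ≤ 2 ^ ⌈log₂ m ⌉) → n ≤ 2 ^ ⌈log₂ n ⌉
  bound zero             _   = z≤n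
  bound (suc zero)       _   = s≤s z≤n
  -- ⌈log₂ (2 + k)⌉ computes to a successor, so the last step holds definitionally.
  bound n@(suc (suc k))  rec = begin
    n                                          ≡⟨ ⌊n/2⌋+⌈n/2⌉≡n n ⟨
    ⌊ n /2⌋ + ⌈ n /2⌉                          ≤⟨ +-monoˡ-≤ ⌈ n /2⌉ (⌊n/2⌋≤⌈n/2⌉ n) ⟩
    ⌈ n /2⌉ + ⌈ n /2⌉                          ≤⟨ +-mono-≤ half≤ half≤ ⟩
    2 ^ (⌈log₂ n ⌉ ∸ 1) + 2 ^ (⌈log₂ n ⌉ ∸ 1)  ≡⟨ cong (2 ^ (⌈log₂ n ⌉ ∸ 1) +_) (+-identityʳ _) ⟨
    2 ^ ⌈log₂ n ⌉                              ∎
    where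
    open ≤-Reasoning
    half≤ : ⌈ n /2⌉ ≤ 2 ^ (⌈log₂ n ⌉ ∸ 1)
    half≤ = subst (λ e → ⌈ n /2⌉ ≤ 2 ^ e) (⌈log₂⌈n/2⌉⌉≡⌈log₂n⌉∸1 n) (rec (⌈n/2⌉<n k))

IsLeast-cong : ∀ {P R : ℕ → Set} → (∀ q → P q ⇔ R q) → ∀ n → IsLeast P n ⇔ IsLeast R n
IsLeast-cong P⇔R n = mk⇔
  (λ (Pn , least) → to (P⇔R n) Pn , λ m Rm → least m (from (P⇔R m) Rm))
  (λ (Rn , least) → from (P⇔R n) Rn , λ m Pm → least m (to (P⇔R m) Pm))

IsLeast-bounded : ∀ {P : ℕ → Set} {m} → P m → ∀ n → IsLeast (λ q → q ≤ m × P q) n ⇔ IsLeast P n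
IsLeast-bounded {P} {m} Pm n = mk⇔ unbound bound
  where
  unbound : IsLeast (λ q → q ≤ m × P q) n → IsLeast P n
  unbound ((n≤m , Pn) , least) = Pn , below
    where
    below : ∀ k → P k → n ≤ k
    below k Pk with ≤-total k m
    ... | inj₁ k≤m = least k (k≤m , Pk)
    ... | inj₂ m≤k = ≤-trans n≤m m≤k
  bound : IsLeast P n → IsLeast (λ q → q ≤ m × P q) n
  bound (Pn , least) = (least m Pm , Pn) , λ k (_ , Pk) → least k Pk

CeilLog2-unique : ∀ {a b k k′} → CeilLog2 a b k → CeilLog2 a b k′ → k ≡ k′
CeilLog2-unique (a≤k , k-least) (a≤k′ , k′-least) = ≤-antisym (k-least _ a≤k′) (k′-least _ a≤k)

CeilLog2-≤⇔ : ∀ {a b k j} → CeilLog2 a b k → (k ≤ j ⇔ a ≤ 2 ^ j * b)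
CeilLog2-≤⇔ {b = b} {j = j} (a≤k , k-least) =
  mk⇔ (λ k≤j → ≤-trans a≤k (*-monoˡ-≤ b (^-monoʳ-≤ 2 k≤j))) (k-least j)

CeilLog2-zero : ∀ {b s} → b ≤ s → CeilLog2 b s 0
CeilLog2-zero {b} {s} b≤s = subst (b ≤_) (sym (*-identityˡ s)) b≤s , λ _ _ → z≤n

CeilLog2-double : ∀ {b s k} → s < b → CeilLog2 b (2 * s) k → CeilLog2 b s (suc k)
CeilLog2-double {b} {s} {k} s<b (b≤ , k-least) = subst (b ≤_) (2^m*[2*o]≡2^[1+m]*o k s) b≤ , least
  where
  least : ∀ j → b ≤ 2 ^ j * s → suc k ≤ j
  least zero    b≤s = contradiction (subst (b ≤_) (*-identityˡ s) b≤s) (<⇒≱ s<b)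
  least (suc j) b≤  = s≤s (k-least j (subst (b ≤_) (sym (2^m*[2*o]≡2^[1+m]*o j s)) b≤))

CeilLog2-2^suc : ∀ m → CeilLog2 (2 ^ suc m) 2 m
CeilLog2-2^suc m = ≤-reflexive (*-comm 2 (2 ^ m)) , λ j h →
  ≤-pred (^-cancelʳ-≤ 2 (s≤s (s≤s z≤n)) (subst (2 ^ suc m ≤_) (*-comm (2 ^ j) 2) h))

CeilLog2-2^* : ∀ q {a b e} → CeilLog2 a b e → (∀ j → 2 ^ q * a ≤ 2 ^ j * b → q ≤ j) →
               CeilLog2 (2 ^ q * a) b (q + e)
CeilLog2-2^* q {a} {b} {e} (a≤ , e-least) q-least =
  subst (2 ^ q * a ≤_) (2^m*[2^n*o]≡2^[m+n]*o q e b) (*-monoʳ-≤ (2 ^ q) a≤) , least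
  where
  least : ∀ j → 2 ^ q * a ≤ 2 ^ j * b → q + e ≤ j
  least j h = subst (q + e ≤_) q+d≡j (+-monoʳ-≤ q (e-least d (*-cancelˡ-≤ (2 ^ q) {{m^n≢0 2 q}} h′)))
    where
    d = j ∸ q
    q+d≡j : q + d ≡ j
    q+d≡j = m+[n∸m]≡n (q-least j h)
    h′ : 2 ^ q * a ≤ 2 ^ q * (2 ^ d * b)
    h′ = subst (2 ^ q * a ≤_) (sym (trans (2^m*[2^n*o]≡2^[m+n]*o q d b) (cong (λ k → 2 ^ k * b) q+d≡j))) h

whileDouble-ceilLog2 : ∀ f {s b} → 1 ≤ s → b ≤ 2 ^ f * s →
  CeilLog2 b s (proj₁ (whileDouble f s b)) × proj₂ (whileDouble f s b) ≡ 2 ^ proj₁ (whileDouble f s b) * s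
whileDouble-ceilLog2 zero    {s} _ b≤s = CeilLog2-zero (subst (_ ≤_) (*-identityˡ s) b≤s) , sym (*-identityˡ s)
whileDouble-ceilLog2 (suc f) {s} {b} 1≤s b≤ with s <? b
... | no  s≮b = CeilLog2-zero (≮⇒≥ s≮b) , sym (*-identityˡ s)
... | yes s<b = CeilLog2-double s<b (proj₁ loop) , trans (proj₂ loop) (2^m*[2*o]≡2^[1+m]*o (proj₁ (whileDouble f (2 * s) b)) s)
  where
  loop = whileDouble-ceilLog2 f (≤-trans 1≤s (m≤m+n s (s + 0))) (subst (b ≤_) (sym (2^m*[2*o]≡2^[1+m]*o f s)) b≤)

inclusivePhase : ∀ m → whileDouble (2 ^ suc m) 2 (2 ^ suc m) ≡ (m , 2 ^ suc m)
inclusivePhase m = ×-≡,≡→≡ (rounds≡m , trans (proj₂ loop) (trans (cong (λ r → 2 ^ r * 2) rounds≡m) (*-comm (2 ^ m) 2)))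
  where
  loop = whileDouble-ceilLog2 (2 ^ suc m) (s≤s z≤n) (m≤n⇒m≤2^n*o ≤-refl (s≤s z≤n))
  rounds≡m = CeilLog2-unique (proj₁ loop) (CeilLog2-2^suc m)

totalRounds-suc : ∀ p m → totalRounds p (suc m) ≡ suc m + proj₁ (whileDouble p (2 ^ suc m ∸ 1) (p ∸ 1))
totalRounds-suc p m rewrite inclusivePhase m = refl

scaled⇒⌈log₂⌉≤ : ∀ {p q j} → 1 ≤ p → 2 ^ q * (p ∸ 1) ≤ 2 ^ j * (2 ^ q ∸ 1) → ⌈log₂ p ⌉ ≤ j
scaled⇒⌈log₂⌉≤ {suc _} {q} {j} _ h = ⌈log₂⌉-least (*-pred-≤⇒< (m^n>0 2 j) (m^n>0 2 q) h)

totalRounds-ceilLog2 : ∀ {p} → 2 ≤ p → ∀ q → 1 ≤ q → q ≤ ⌈log₂ p ⌉ →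
                       CeilLog2 (2 ^ q * (p ∸ 1)) (2 ^ q ∸ 1) (totalRounds p q)
totalRounds-ceilLog2 {p} 2≤p (suc m) _ q≤Q =
  subst (CeilLog2 (2 ^ suc m * (p ∸ 1)) (2 ^ suc m ∸ 1)) (sym (totalRounds-suc p m))
    (CeilLog2-2^* (suc m) exclusive λ j h → ≤-trans q≤Q (scaled⇒⌈log₂⌉≤ {q = suc m} (≤-trans (s≤s z≤n) 2≤p) h))
  where
  1≤s : 1 ≤ 2 ^ suc m ∸ 1
  1≤s = ∸-monoˡ-≤ 1 (^-monoʳ-≤ 2 {1} {suc m} (s≤s z≤n))
  exclusive : CeilLog2 (p ∸ 1) (2 ^ suc m ∸ 1) (proj₁ (whileDouble p (2 ^ suc m ∸ 1) (p ∸ 1)))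
  exclusive = proj₁ (whileDouble-ceilLog2 p 1≤s (m≤n⇒m≤2^n*o (m∸n≤m p 1) 1≤s))

-- Both sides are equivalent to Y + X p ≤ X Y + X.
scaled⇔BoundCond : ∀ {X Y p} → 1 ≤ X → 1 ≤ p → p ≤ Y + 1 →
                   X * (p ∸ 1) ≤ Y * (X ∸ 1) ⇔ Y ≤ X * (Y + 1 ∸ p)
scaled⇔BoundCond {suc x} {Y} {suc r} _ _ p≤Y+1 =
  ⇔-sym (≤-translate (suc x * suc r) refl rhs) ⇔-∘ ≤-translate (suc x + Y) (lhs x r Y) (mid x Y)
  where
  lhs : ∀ x r Y → suc x * r + (suc x + Y) ≡ Y + suc x * suc r
  lhs = solve-∀
  mid : ∀ x Y → Y * x + (suc x + Y) ≡ suc x * Y + suc x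
  mid = solve-∀
  d = Y + 1 ∸ suc r
  rhs : suc x * d + suc x * suc r ≡ suc x * Y + suc x
  rhs = begin
    suc x * d + suc x * suc r  ≡⟨ *-distribˡ-+ (suc x) d (suc r) ⟨
    suc x * (d + suc r)        ≡⟨ cong (suc x *_) (m∸n+n≡m p≤Y+1) ⟩
    suc x * (Y + 1)            ≡⟨ *-distribˡ-+ (suc x) Y 1 ⟩
    suc x * Y + suc x * 1      ≡⟨ cong (suc x * Y +_) (*-identityʳ (suc x)) ⟩
    suc x * Y + suc x          ∎
    where open ≡-Reasoning

BoundCond-⌈log₂⌉ : ∀ p → BoundCond p ⌈log₂ p ⌉ ⌈log₂ p ⌉
BoundCond-⌈log₂⌉ p = m≤m*n (2 ^ ⌈log₂ p ⌉) _ {{>-nonZero (m<n⇒0<n∸m p<Y+1)}}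
  where
  p<Y+1 : p < 2 ^ ⌈log₂ p ⌉ + 1
  p<Y+1 = ≤-<-trans (n≤2^⌈log₂n⌉ p) (m<m+n (2 ^ ⌈log₂ p ⌉) (s≤s z≤n))

rounds≡⌈log₂⌉⇔BoundCond : ∀ {p} → 2 ≤ p → ∀ q →
  (1 ≤ q × q ≤ ⌈log₂ p ⌉ × totalRounds p q ≡ ⌈log₂ p ⌉) ⇔ (q ≤ ⌈log₂ p ⌉ × BoundCond p ⌈log₂ p ⌉ q)
rounds≡⌈log₂⌉⇔BoundCond {p@(suc (suc _))} 2≤p@(s≤s (s≤s z≤n)) q = mk⇔ to′ from′
  where
  Q = ⌈log₂ p ⌉
  1≤p : 1 ≤ p
  1≤p = s≤s z≤n
  scaled⇔ : ∀ q → 2 ^ q * (p ∸ 1) ≤ 2 ^ Q * (2 ^ q ∸ 1) ⇔ BoundCond p Q q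
  scaled⇔ q = scaled⇔BoundCond (m^n>0 2 q) 1≤p (≤-trans (n≤2^⌈log₂n⌉ p) (m≤m+n (2 ^ Q) 1))
  positive : ∀ {q} → BoundCond p Q q → 1 ≤ q
  positive {zero}  b = ⊥-elim (n≮0 (subst (1 * (p ∸ 1) ≤_) (*-zeroʳ (2 ^ Q)) (from (scaled⇔ 0) b)))
  positive {suc _} _ = s≤s z≤n
  to′ : 1 ≤ q × q ≤ Q × totalRounds p q ≡ Q → q ≤ Q × BoundCond p Q q
  to′ (1≤q , q≤Q , rounds≡Q) =
    q≤Q , to (scaled⇔ q) (to (CeilLog2-≤⇔ (totalRounds-ceilLog2 2≤p q 1≤q q≤Q)) (≤-reflexive rounds≡Q))
  from′ : q ≤ Q × BoundCond p Q q → 1 ≤ q × q ≤ Q × totalRounds p q ≡ Q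
  from′ (q≤Q , b) = 1≤q , q≤Q , ≤-antisym (from (CeilLog2-≤⇔ rounds) (from (scaled⇔ q) b))
                                          (scaled⇒⌈log₂⌉≤ {q = q} 1≤p (proj₁ rounds))
    where
    1≤q = positive b
    rounds = totalRounds-ceilLog2 2≤p q 1≤q q≤Q

corollary1 : (p : ℕ) → 2 ≤ p →
    (∀ q' → 1 ≤ q' → q' ≤ ⌈log₂ p ⌉ →
      CeilLog2 (2 ^ q' * (p ∸ 1)) (2 ^ q' ∸ 1) (totalRounds p q'))
    × (∀ q' → IsLeast (λ q → 1 ≤ q × q ≤ ⌈log₂ p ⌉ × totalRounds p q ≡ ⌈log₂ p ⌉) q'
              ⇔ IsLeast (λ q → BoundCond p ⌈log₂ p ⌉ q) q')
corollary1 p 2≤p = totalRounds-ceilLog2 2≤p , λ q →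
  IsLeast-bounded (BoundCond-⌈log₂⌉ p) q ⇔-∘ IsLeast-cong (rounds≡⌈log₂⌉⇔BoundCond 2≤p) q
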